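{- Let $\underline{S_1}=\lambda n\lambda f\lambda x (f)((n)f)x$. A closed $\lambda$-term $T$ is an $\underline{S_1}$-storage operator iff $T$ is a storage operator.
   Context: Notation: $(t)u$ denotes application of $t$ to $u$, and $(t)u_1\dots u_n$ stands for $(\dots((t)u_1)\dots)u_n$; $\overline{c}$ denotes a finite sequence of terms. $u \succ v$ means $v$ is obtained from $u$ by finitely many head-reduction steps. $(u)^0v=v$, $(u)^{n+1}v=(u)(u)^nv$. Church integers: $\underline{n}=\lambda f\lambda x (f)^n x$. A closed $\lambda$-term $\underline{S}$ is a successor iff $(\underline{S})\underline{k}\simeq_\beta \underline{k+1}$ for every $k\ge 0$ ($\underline{S_1}$ is a successor). A closed $\lambda$-term $T$ is a storage operator iff for every $n\ge 0$ there is a closed $\lambda$-term $\tau_n\simeq_\beta \underline{n}$ such that for every $\theta_n\simeq_\beta\underline{n}$, $(T)\theta_n f \succ (f)\tau_n$ (where $f$ is a fresh variable). $\lambda X$-terms: terms built from variables and constants $X_i$ ($i\ge 0$) by abstraction and application, together with constants $X_{n,a,b,\overline{c}}$ for every $n\in\mathbb N$ and $\lambda X$-terms $a,b,\overline{c}$ ($X_{n,a,b,\overline{c}}$ is regarded as a constant not occurring in $a,b,\overline{c}$). Given a successor $\underline{S}$, a closed $\lambda$-term $T$ is an $\underline{S}$-storage operator iff for every $n\ge 0$ there is a finite sequence of head reductions $U_i\succ V_i$ ($1\le i\le r$) such that: (1) all $U_i,V_i$ are $\lambda X$-terms; (2) $U_1=(T)X_n f$ and $V_r=(f)\tau_n$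 with $\tau_n$ a closed $\lambda$-term $\beta$-equivalent to $\underline{n}$; (3) for $i<r$, $V_i=(X_n)ab\overline{c}$ or $V_i=(X_{l,a,b,\overline{c}})uv\overline{w}$ with $0\le l\le n-1$; (4) if $V_i=(X_n)ab\overline{c}$ then $U_{i+1}=(\underline{0})ab\overline{c}$ if $n=0$ and $U_{i+1}=((\underline{S})X_{n-1,a,b,\overline{c}})ab\overline{c}$ if $n\ne 0$; (5) if $V_i=(X_{l,a,b,\overline{c}})uv\overline{w}$ then $U_{i+1}=(\underline{0})uv\overline{w}$ if $l=0$ and $U_{i+1}=((\underline{S})X_{l-1,u,v,\overline{w}})uv\overline{w}$ if $l\ne 0$. -}

module Defs where

open import Data.Nat using (ℕ; zero; suc; _+_; _<_; _<ᵇ_; _≡ᵇ_; pred)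
open import Relation.Binary.PropositionalEquality using (_≡_)
open import Data.Bool using (if_then_else_)
open import Data.List using (List; []; _∷_)
open import Data.Product using (Σ; _×_; _,_)
open import Relation.Binary.Construct.Closure.ReflexiveTransitive using (Star)
open import Relation.Binary.Construct.Closure.Equivalence using (EqClosure)

-- λX-terms, with de Bruijn indices for variables.
--   X i            : the constant X_i
--   Xc n a b c̄     : the constant X_{n,a,b,c̄}
-- Constants are atomic: substitution / shifting do not enter them.
-- Pure λ-terms are the λX-terms without constants (predicate WS below).

data Tm : Set where
  var : ℕ → Tm
  lam : Tm → Tm
  app : Tm → Tm → Tm
  X   : ℕ → Tm
  Xc  : ℕ → Tm → Tm → List Tm → Tm

apps : Tm → List Tm → Tm
apps t []       = t
apps t (u ∷ us) = apps (app t u) us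

shift : ℕ → Tm → Tm
shift c (var i)       = if i <ᵇ c then var i else var (suc i)
shift c (lam t)       = lam (shift (suc c) t)
shift c (app t u)     = app (shift c t) (shift c u)
shift c (X i)         = X i
shift c (Xc n a b cs) = Xc n a b cs

-- subst k s t : replace variable k by s in t (s is already in the
-- context of t under k binders), decrementing variables above k
subst : ℕ → Tm → Tm → Tm
subst k s (var i)       = if i <ᵇ k then var i else (if i ≡ᵇ k then s else var (pred i))
subst k s (lam t)       = lam (subst (suc k) (shift 0 s) t)
subst k s (app t u)     = app (subst k s t) (subst k s u)
subst k s (X i)         = X i
subst k s (Xc n a b cs) = Xc n a b cs

data WS (k : ℕ) : Tm → Set where
  var : ∀ {i} → i < k → WS k (var i)
  lam : ∀ {t} → WS (suc k) t → WS k (lam t)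
  app : ∀ {t u} → WS k t → WS k u → WS k (app t u)

ClosedΛ : Tm → Set
ClosedΛ = WS 0

infix 4 _⟶β_ _≃β_ _⟶w_ _⟶h_ _≻_

data _⟶β_ : Tm → Tm → Set where
  β    : ∀ {u v} → app (lam u) v ⟶β subst 0 v u
  lamβ : ∀ {t t'} → t ⟶β t' → lam t ⟶β lam t'
  appl : ∀ {t t' u} → t ⟶β t' → app t u ⟶β app t' u
  appr : ∀ {t u u'} → u ⟶β u' → app t u ⟶β app t u'

_≃β_ : Tm → Tm → Set
_≃β_ = EqClosure _⟶β_

-- Head reduction: (λx u) v w̄ reduces to u[v/x] w̄, possibly under
-- leading abstractions.  u ≻ v : finitely many (possibly zero) steps.

data _⟶w_ : Tm → Tm → Set where
  β    : ∀ {u v} → app (lam u) v ⟶w subst 0 v u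
  appl : ∀ {t t' u} → t ⟶w t' → app t u ⟶w app t' u

data _⟶h_ : Tm → Tm → Set where
  wh   : ∀ {t t'} → t ⟶w t' → t ⟶h t'
  lamh : ∀ {t t'} → t ⟶h t' → lam t ⟶h lam t'

_≻_ : Tm → Tm → Set
_≻_ = Star _⟶h_

iter : ℕ → (Tm → Tm) → Tm → Tm
iter zero    g x = x
iter (suc n) g x = g (iter n g x)

-- λf λx (f)^n x   (f = var 1, x = var 0)
church : ℕ → Tm
church n = lam (lam (iter n (app (var 1)) (var 0)))

-- λn λf λx (f)((n)f)x   (n = var 2, f = var 1, x = var 0)
S₁ : Tm
S₁ = lam (lam (lam (app (var 1) (app (app (var 2) (var 1)) (var 0)))))

-- the fresh variable f: since all other terms involved are closed, var 0
fv : Tm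
fv = var 0

StorageOperator : Tm → Set
StorageOperator T =
  (n : ℕ) → Σ Tm λ τ → ClosedΛ τ × τ ≃β church n ×
    ((θ : Tm) → ClosedΛ θ → θ ≃β church n → app (app T θ) fv ≻ app fv τ)

-- S-storage operators.
-- Next S n V U' : V has the shape of condition (3) (for i < r) and U'
-- is the term U_{i+1} prescribed by conditions (4)/(5).

data Next (S : Tm) (n : ℕ) : Tm → Tm → Set where
  x-zero : ∀ {a b cs} → n ≡ 0 →
           Next S n (apps (X n) (a ∷ b ∷ cs)) (apps (church 0) (a ∷ b ∷ cs))
  x-suc  : ∀ {m a b cs} → n ≡ suc m →
           Next S n (apps (X n) (a ∷ b ∷ cs))
                    (apps (app S (Xc m a b cs)) (a ∷ b ∷ cs))
  c-zero : ∀ {a b cs u v ws} → 0 < n →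
           Next S n (apps (Xc 0 a b cs) (u ∷ v ∷ ws)) (apps (church 0) (u ∷ v ∷ ws))
  c-suc  : ∀ {l a b cs u v ws} → suc l < n →
           Next S n (apps (Xc (suc l) a b cs) (u ∷ v ∷ ws))
                    (apps (app S (Xc l u v ws)) (u ∷ v ∷ ws))

-- Reaches S n U : there is a finite chain U = U₁ ≻ V₁, U₂ ≻ V₂, …, U_r ≻ V_r
-- obeying (3)–(5), with V_r = (f)τ, τ a closed λ-term β-equivalent to n.
data Reaches (S : Tm) (n : ℕ) : Tm → Set where
  final : ∀ {U} τ → U ≻ app fv τ → ClosedΛ τ → τ ≃β church n → Reaches S n U
  step  : ∀ {U V U'} → U ≻ V → Next S n V U' → Reaches S n U' → Reaches S n U

SStorageOperator : Tm → Tm → Set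
SStorageOperator S T = (n : ℕ) → Reaches S n (app (app T (X n)) fv)

-- Both directions run the λX-reduction of (T)X_n f alongside real head reductions, through a
-- simulation that replaces X_n by a numeral θ and each applied constant (X_{l,a,b,c̄})A B by a
-- term that head-reduces like (l)A B.
--
-- If T is an S₁-storage operator and θ ≃β n, then Church–Rosser and standardisation show that
-- (θ)a b head-reduces like (a)^n b, one layer at a time. Every step of the λX-chain for n is then
-- matched by head reductions of (T)θ f: the hand-over (S₁)X_{l-1,u,v,w̄} u v w̄ head-reduces to
-- (u)((X_{l-1,u,v,w̄})u v)w̄, whose image is one layer of the unfolding. The chain ends at (f)τ.
--
-- Conversely, if T is a storage operator, (T)n f and (T)nᴵ f both head-reduce to the same (f)τ,
-- where nᴵ is the numeral n with an identity redex in front of every subterm. The λX-term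
-- (T)X_n f is reduced in lock-step with both; whenever its head is a constant, the step of the
-- chain prescribed by (4)/(5) is taken. The reduction of (T)nᴵ f strictly shortens each time, so
-- this terminates, at some (f)τ₀ that both simulations map to (f)τ. The image of every constant
-- is strictly larger under the padded numeral, so τ₀ contains no constant and equals τ.

module Submission where

open import Defs
open import Data.Bool using (true; false)
open import Data.Empty using (⊥-elim)
open import Data.List using (List; []; _∷_; _∷ʳ_)
open import Data.List.Relation.Binary.Pointwise using (Pointwise; []; _∷_)
open import Data.Nat using (ℕ; zero; suc; pred; _+_; _≤_; _<_; z≤n; s≤s; _<ᵇ_; _≡ᵇ_)
open import Data.Nat.Properties
  using ( ≤-refl; ≤-reflexive; ≤-trans; ≤-pred; n≤1+n; m≤n⇒m≤1+n; <⇒≤; <-trans; <-irrefl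
        ; <-cmp; ≤-<-trans; <-≤-trans; n<1+n; +-mono-≤ )
open import Data.Product using (Σ; ∃; _×_; _,_; proj₁)
open import Data.Sum using (_⊎_; inj₁; inj₂)
open import Function using (id)
open import Function.Bundles using (_⇔_; mk⇔)
open import Relation.Binary.Definitions using (tri<; tri≈; tri>)
open import Relation.Binary.PropositionalEquality
  using (_≡_; refl; sym; trans; cong; cong₂; module ≡-Reasoning) renaming (subst to transport)
open import Relation.Binary.Construct.Closure.ReflexiveTransitive using (Star; ε; _◅_; _◅◅_; gmap)
open import Relation.Binary.Construct.Closure.Symmetric using (fwd; bwd)
open import Relation.Nullary using (¬_)

<⇒<ᵇ≡true : ∀ {i k} → i < k → (i <ᵇ k) ≡ true
<⇒<ᵇ≡true {zero}  {suc k} _       = refl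
<⇒<ᵇ≡true {suc i} {suc k} (s≤s p) = <⇒<ᵇ≡true p

≥⇒<ᵇ≡false : ∀ {i k} → k ≤ i → (i <ᵇ k) ≡ false
≥⇒<ᵇ≡false {i}     {zero}  _       = refl
≥⇒<ᵇ≡false {suc i} {suc k} (s≤s p) = ≥⇒<ᵇ≡false p

≡ᵇ-refl : ∀ k → (k ≡ᵇ k) ≡ true
≡ᵇ-refl zero    = refl
≡ᵇ-refl (suc k) = ≡ᵇ-refl k

>⇒≡ᵇ≡false : ∀ {i k} → k < i → (i ≡ᵇ k) ≡ false
>⇒≡ᵇ≡false {suc i} {zero}  _       = refl
>⇒≡ᵇ≡false {suc i} {suc k} (s≤s p) = >⇒≡ᵇ≡false p

shift-var< : ∀ {i c} → i < c → shift c (var i) ≡ var i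
shift-var< p rewrite <⇒<ᵇ≡true p = refl

shift-var≥ : ∀ {i c} → c ≤ i → shift c (var i) ≡ var (suc i)
shift-var≥ p rewrite ≥⇒<ᵇ≡false p = refl

subst-var< : ∀ {i k s} → i < k → subst k s (var i) ≡ var i
subst-var< p rewrite <⇒<ᵇ≡true p = refl

subst-var≡ : ∀ {k s} → subst k s (var k) ≡ s
subst-var≡ {k} rewrite ≥⇒<ᵇ≡false {k} {k} ≤-refl | ≡ᵇ-refl k = refl

subst-var> : ∀ {i k s} → k < i → subst k s (var i) ≡ var (pred i)
subst-var> p rewrite ≥⇒<ᵇ≡false (<⇒≤ p) | >⇒≡ᵇ≡false p = refl

subst-shift-cancel : ∀ k s t → subst k s (shift k t) ≡ t
subst-shift-cancel k s (var i) with <-cmp i k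
... | tri< i<k _ _ rewrite shift-var< i<k = subst-var< i<k
... | tri≈ _ refl _ rewrite shift-var≥ {i} {i} ≤-refl = subst-var> (n<1+n i)
... | tri> _ _ k<i rewrite shift-var≥ (<⇒≤ k<i) = subst-var> (<-trans k<i (n<1+n i))
subst-shift-cancel k s (lam t)       = cong lam (subst-shift-cancel (suc k) (shift 0 s) t)
subst-shift-cancel k s (app t u)     = cong₂ app (subst-shift-cancel k s t) (subst-shift-cancel k s u)
subst-shift-cancel k s (X i)         = refl
subst-shift-cancel k s (Xc n a b cs) = refl

shift-shift-comm : ∀ d c t → d ≤ c → shift (suc c) (shift d t) ≡ shift d (shift c t)
shift-shift-comm d c (var i) d≤c with <-cmp i d
... | tri< i<d _ _
  rewrite shift-var< i<d | shift-var< (<-≤-trans i<d d≤c)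
        | shift-var< (<-trans (<-≤-trans i<d d≤c) (n<1+n c)) | shift-var< i<d = refl
... | tri≈ _ refl _ with <-cmp i c
...   | tri< i<c _ _
  rewrite shift-var≥ {i} {i} ≤-refl | shift-var< i<c
        | shift-var< (s≤s i<c) | shift-var≥ {i} {i} ≤-refl = refl
...   | tri≈ _ refl _
  rewrite shift-var≥ {i} {i} ≤-refl | shift-var≥ {suc i} {suc i} ≤-refl
        | shift-var≥ {suc i} {i} (n≤1+n i) = refl
...   | tri> _ _ c<i = ⊥-elim (<-irrefl refl (≤-<-trans d≤c c<i))
shift-shift-comm d c (var i) d≤c | tri> _ _ d<i with <-cmp i c
...   | tri< i<c _ _
  rewrite shift-var≥ (<⇒≤ d<i) | shift-var< i<c
        | shift-var< (s≤s i<c) | shift-var≥ (<⇒≤ d<i) = refl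
...   | tri≈ _ refl _
  rewrite shift-var≥ (<⇒≤ d<i) | shift-var≥ {suc i} {suc i} ≤-refl
        | shift-var≥ {i} {i} ≤-refl | shift-var≥ (m≤n⇒m≤1+n (<⇒≤ d<i)) = refl
...   | tri> _ _ c<i
  rewrite shift-var≥ (<⇒≤ d<i) | shift-var≥ (s≤s (<⇒≤ c<i))
        | shift-var≥ (<⇒≤ c<i) | shift-var≥ (m≤n⇒m≤1+n (<⇒≤ d<i)) = refl
shift-shift-comm d c (lam t)       d≤c = cong lam (shift-shift-comm (suc d) (suc c) t (s≤s d≤c))
shift-shift-comm d c (app t u)     d≤c = cong₂ app (shift-shift-comm d c t d≤c) (shift-shift-comm d c u d≤c)
shift-shift-comm d c (X i)         d≤c = refl
shift-shift-comm d c (Xc n a b cs) d≤c = refl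

shift-subst-above : ∀ k c s t → k ≤ c →
  shift c (subst k s t) ≡ subst k (shift c s) (shift (suc c) t)
shift-subst-above k c s (var i) k≤c with <-cmp i k
... | tri< i<k _ _
  rewrite subst-var< {s = s} i<k | shift-var< (<-≤-trans i<k k≤c)
        | shift-var< (<-≤-trans i<k (m≤n⇒m≤1+n k≤c)) | subst-var< {s = shift c s} i<k = refl
... | tri≈ _ refl _
  rewrite subst-var≡ {i} {s} | shift-var< (s≤s k≤c) | subst-var≡ {i} {shift c s} = refl
shift-subst-above k c s (var (suc i)) k≤c | tri> _ _ k<i with <-cmp i c
...   | tri< i<c _ _
  rewrite subst-var> {s = s} k<i | shift-var< i<c
        | shift-var< (s≤s i<c) | subst-var> {s = shift c s} k<i = refl
...   | tri≈ _ refl _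
  rewrite subst-var> {s = s} k<i | shift-var≥ {i} {i} ≤-refl
        | shift-var≥ {suc i} {suc i} ≤-refl | subst-var> {s = shift i s} (m≤n⇒m≤1+n k<i) = refl
...   | tri> _ _ c<i
  rewrite subst-var> {s = s} k<i | shift-var≥ (<⇒≤ c<i)
        | shift-var≥ (s≤s (<⇒≤ c<i)) | subst-var> {s = shift c s} (m≤n⇒m≤1+n k<i) = refl
shift-subst-above k c s (lam t) k≤c
  rewrite shift-subst-above (suc k) (suc c) (shift 0 s) t (s≤s k≤c) | shift-shift-comm 0 c s z≤n = refl
shift-subst-above k c s (app t u)     k≤c =
  cong₂ app (shift-subst-above k c s t k≤c) (shift-subst-above k c s u k≤c)
shift-subst-above k c s (X i)         k≤c = refl
shift-subst-above k c s (Xc n a b cs) k≤c = refl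

shift-subst-below : ∀ c k s t → c ≤ k →
  shift c (subst k s t) ≡ subst (suc k) (shift c s) (shift c t)
shift-subst-below c k s (var i) c≤k with <-cmp i k
shift-subst-below c k s (var i) c≤k | tri< i<k _ _ with <-cmp i c
...   | tri< i<c _ _
  rewrite subst-var< {s = s} i<k | shift-var< i<c | subst-var< {s = shift c s} (<-trans i<k (n<1+n k)) = refl
...   | tri≈ _ refl _
  rewrite subst-var< {s = s} i<k | shift-var≥ {i} {i} ≤-refl | subst-var< {s = shift i s} (s≤s i<k) = refl
...   | tri> _ _ c<i
  rewrite subst-var< {s = s} i<k | shift-var≥ (<⇒≤ c<i) | subst-var< {s = shift c s} (s≤s i<k) = refl
shift-subst-below c k s (var i) c≤k | tri≈ _ refl _
  rewrite subst-var≡ {i} {s} | shift-var≥ c≤k | subst-var≡ {suc i} {shift c s} = refl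
shift-subst-below c k s (var (suc i)) c≤k | tri> _ _ k<i
  rewrite subst-var> {s = s} k<i | shift-var≥ (≤-trans c≤k (≤-pred k<i))
        | shift-var≥ (m≤n⇒m≤1+n (≤-trans c≤k (≤-pred k<i))) | subst-var> {s = shift c s} (s≤s k<i) = refl
shift-subst-below c k s (lam t) c≤k
  rewrite shift-subst-below (suc c) (suc k) (shift 0 s) t (s≤s c≤k) | shift-shift-comm 0 c s z≤n = refl
shift-subst-below c k s (app t u)     c≤k =
  cong₂ app (shift-subst-below c k s t c≤k) (shift-subst-below c k s u c≤k)
shift-subst-below c k s (X i)         c≤k = refl
shift-subst-below c k s (Xc n a b cs) c≤k = refl

subst-subst-comm : ∀ j k s v u → j ≤ k →
  subst k s (subst j v u) ≡ subst j (subst k s v) (subst (suc k) (shift j s) u)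
subst-subst-comm j k s v (var i) j≤k with <-cmp i j
... | tri< i<j _ _
  rewrite subst-var< {s = v} i<j | subst-var< {s = s} (<-≤-trans i<j j≤k)
        | subst-var< {s = shift j s} (<-≤-trans i<j (m≤n⇒m≤1+n j≤k)) | subst-var< {s = subst k s v} i<j = refl
... | tri≈ _ refl _
  rewrite subst-var≡ {i} {v} | subst-var< {s = shift i s} (s≤s j≤k) | subst-var≡ {i} {subst k s v} = refl
subst-subst-comm j k s v (var (suc i)) j≤k | tri> _ _ j<i with <-cmp i k
...   | tri< i<k _ _
  rewrite subst-var> {s = v} j<i | subst-var< {s = s} i<k
        | subst-var< {s = shift j s} (s≤s i<k) | subst-var> {s = subst k s v} j<i = refl
...   | tri≈ _ refl _
  rewrite subst-var> {s = v} j<i | subst-var≡ {i} {s} | subst-var≡ {suc i} {shift j s} =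
    sym (subst-shift-cancel j (subst i s v) s)
subst-subst-comm j k s v (var (suc (suc i))) j≤k | tri> _ _ j<i | tri> _ _ k<i
  rewrite subst-var> {s = v} j<i | subst-var> {s = s} k<i
        | subst-var> {s = shift j s} (s≤s k<i) | subst-var> {s = subst k s v} (≤-<-trans j≤k k<i) = refl
subst-subst-comm j k s v (lam u) j≤k
  rewrite subst-subst-comm (suc j) (suc k) (shift 0 s) (shift 0 v) u (s≤s j≤k)
        | shift-shift-comm 0 j s z≤n | sym (shift-subst-below 0 k s v z≤n) = refl
subst-subst-comm j k s v (app t u)     j≤k =
  cong₂ app (subst-subst-comm j k s v t j≤k) (subst-subst-comm j k s v u j≤k)
subst-subst-comm j k s v (X i)         j≤k = refl
subst-subst-comm j k s v (Xc n a b cs) j≤k = refl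

WS⇒shift-id : ∀ {k c t} → WS k t → k ≤ c → shift c t ≡ t
WS⇒shift-id (var i<k) k≤c = shift-var< (<-≤-trans i<k k≤c)
WS⇒shift-id (lam w)   k≤c = cong lam (WS⇒shift-id w (s≤s k≤c))
WS⇒shift-id (app w v) k≤c = cong₂ app (WS⇒shift-id w k≤c) (WS⇒shift-id v k≤c)

WS⇒subst-id : ∀ {k j s t} → WS k t → k ≤ j → subst j s t ≡ t
WS⇒subst-id (var i<k) k≤j = subst-var< (<-≤-trans i<k k≤j)
WS⇒subst-id (lam w)   k≤j = cong lam (WS⇒subst-id w (s≤s k≤j))
WS⇒subst-id (app w v) k≤j = cong₂ app (WS⇒subst-id w k≤j) (WS⇒subst-id v k≤j)

WS-weaken : ∀ {k k′ t} → WS k t → k ≤ k′ → WS k′ t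
WS-weaken (var i<k) k≤k′ = var (<-≤-trans i<k k≤k′)
WS-weaken (lam w)   k≤k′ = lam (WS-weaken w (s≤s k≤k′))
WS-weaken (app w v) k≤k′ = app (WS-weaken w k≤k′) (WS-weaken v k≤k′)

-- Weak head reduction

infix 4 _⟶w*_
_⟶w*_ : Tm → Tm → Set
_⟶w*_ = Star _⟶w_

⟶w-shift : ∀ c {t t′} → t ⟶w t′ → shift c t ⟶w shift c t′
⟶w-shift c (β {u} {v}) rewrite shift-subst-above 0 c v u z≤n = β
⟶w-shift c (appl r)            = appl (⟶w-shift c r)

⟶w-subst : ∀ k s {t t′} → t ⟶w t′ → subst k s t ⟶w subst k s t′
⟶w-subst k s (β {u} {v}) rewrite subst-subst-comm 0 k s v u z≤n = β
⟶w-subst k s (appl r)            = appl (⟶w-subst k s r)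

⟶w-apps : ∀ {t t′} us → t ⟶w t′ → apps t us ⟶w apps t′ us
⟶w-apps []       r = r
⟶w-apps (u ∷ us) r = ⟶w-apps us (appl r)

⟶w*-shift : ∀ c {t t′} → t ⟶w* t′ → shift c t ⟶w* shift c t′
⟶w*-shift c = gmap (shift c) (⟶w-shift c)

⟶w*-subst : ∀ k s {t t′} → t ⟶w* t′ → subst k s t ⟶w* subst k s t′
⟶w*-subst k s = gmap (subst k s) (⟶w-subst k s)

⟶w*-apps : ∀ {t t′} us → t ⟶w* t′ → apps t us ⟶w* apps t′ us
⟶w*-apps us = gmap (λ t → apps t us) (⟶w-apps us)

⟶w*-appl : ∀ {t t′ u} → t ⟶w* t′ → app t u ⟶w* app t′ u
⟶w*-appl {u = u} = gmap (λ t → app t u) appl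

⟶w*⇒≻ : ∀ {t t′} → t ⟶w* t′ → t ≻ t′
⟶w*⇒≻ = gmap id wh

⟶w-deterministic : ∀ {t t₁ t₂} → t ⟶w t₁ → t ⟶w t₂ → t₁ ≡ t₂
⟶w-deterministic β        β        = refl
⟶w-deterministic (appl r) (appl q) = cong (λ t → app t _) (⟶w-deterministic r q)

WhNF : Tm → Set
WhNF t = ∀ {t′} → ¬ (t ⟶w t′)

length : ∀ {t t′} → t ⟶w* t′ → ℕ
length ε       = 0
length (_ ◅ s) = suc (length s)

⟶w-toward-WhNF : ∀ {t t′ g} → t ⟶w t′ → (s : t ⟶w* g) → WhNF g →
  Σ (t′ ⟶w* g) λ s′ → length s′ < length s
⟶w-toward-WhNF r ε       g-nf = ⊥-elim (g-nf r)
⟶w-toward-WhNF r (q ◅ s) g-nf rewrite ⟶w-deterministic r q = s , n<1+n (length s)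

⟶w*-toward-WhNF : ∀ {t t′ g} → t ⟶w* t′ → (s : t ⟶w* g) → WhNF g →
  Σ (t′ ⟶w* g) λ s′ → length s′ ≤ length s
⟶w*-toward-WhNF ε       s g-nf = s , ≤-refl
⟶w*-toward-WhNF (r ◅ rs) s g-nf with ⟶w-toward-WhNF r s g-nf
... | s₁ , s₁<s with ⟶w*-toward-WhNF rs s₁ g-nf
...   | s₂ , s₂≤s₁ = s₂ , ≤-trans s₂≤s₁ (<⇒≤ s₁<s)

data Neutral : Tm → Set where
  var : ∀ {i} → Neutral (var i)
  X   : ∀ {i} → Neutral (X i)
  Xc  : ∀ {l a b cs} → Neutral (Xc l a b cs)
  app : ∀ {t u} → Neutral t → Neutral (app t u)

Neutral⇒WhNF : ∀ {t} → Neutral t → WhNF t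
Neutral⇒WhNF (app ()) β
Neutral⇒WhNF (app t-ne) (appl r) = Neutral⇒WhNF t-ne r

Neutral-apps : ∀ {t} us → Neutral t → Neutral (apps t us)
Neutral-apps []       t-ne = t-ne
Neutral-apps (u ∷ us) t-ne = Neutral-apps us (app t-ne)

≻-lam : ∀ {t g} → lam t ≻ g → ∃ λ g′ → g ≡ lam g′
≻-lam ε                = _ , refl
≻-lam (wh () ◅ _)
≻-lam (lamh _ ◅ h)     = ≻-lam h

-- head reduction to a neutral term never goes under a λ
≻-Neutral⇒⟶w* : ∀ {t g} → t ≻ g → Neutral g → t ⟶w* g
≻-Neutral⇒⟶w* ε            g-ne = ε
≻-Neutral⇒⟶w* (wh r ◅ h)   g-ne = r ◅ ≻-Neutral⇒⟶w* h g-ne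
≻-Neutral⇒⟶w* (lamh _ ◅ h) g-ne with ≻-lam h
≻-Neutral⇒⟶w* (lamh _ ◅ h) () | _ , refl

lam-⟶w*-app : ∀ {t u v} → ¬ (lam t ⟶w* app u v)
lam-⟶w*-app (() ◅ _)

apps-∷ʳ : ∀ t us u → apps t (us ∷ʳ u) ≡ app (apps t us) u
apps-∷ʳ t []       u = refl
apps-∷ʳ t (v ∷ us) u = apps-∷ʳ (app t v) us u

iter-hom : (f : Tm → Tm) → (∀ {t u} → f (app t u) ≡ app (f t) (f u)) →
  ∀ l A B → f (iter l (app A) B) ≡ iter l (app (f A)) (f B)
iter-hom f f-app zero    A B = refl
iter-hom f f-app (suc l) A B = trans f-app (cong (app (f A)) (iter-hom f f-app l A B))

WS-iter : ∀ {k} l {A B} → WS k A → WS k B → WS k (iter l (app A) B)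
WS-iter zero    A-ws B-ws = B-ws
WS-iter (suc l) A-ws B-ws = app A-ws (WS-iter l A-ws B-ws)

church-closed : ∀ n → ClosedΛ (church n)
church-closed n = lam (lam (WS-iter n (var (s≤s (s≤s z≤n))) (var (s≤s z≤n))))

church-⟶w* : ∀ l a b → app (app (church l) a) b ⟶w* iter l (app a) b
church-⟶w* l a b = transport (app (app (church l) a) b ⟶w*_) reduct (appl β ◅ β ◅ ε)
  where
  open ≡-Reasoning
  reduct : subst 0 b (subst 1 (shift 0 a) (iter l (app (var 1)) (var 0))) ≡ iter l (app a) b
  reduct = begin
    subst 0 b (subst 1 (shift 0 a) (iter l (app (var 1)) (var 0)))
      ≡⟨ cong (subst 0 b) (iter-hom (subst 1 (shift 0 a)) refl l (var 1) (var 0)) ⟩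
    subst 0 b (iter l (app (shift 0 a)) (var 0))
      ≡⟨ iter-hom (subst 0 b) refl l (shift 0 a) (var 0) ⟩
    iter l (app (subst 0 b (shift 0 a))) b
      ≡⟨ cong (λ a′ → iter l (app a′) b) (subst-shift-cancel 0 b a) ⟩
    iter l (app a) b
      ∎

-- The term U_{i+1} of conditions (4) and (5), for a head constant standing for the integer l.
restart : ℕ → Tm → Tm → List Tm → Tm
restart zero    a b cs = apps (church 0) (a ∷ b ∷ cs)
restart (suc l) a b cs = apps (app S₁ (Xc l a b cs)) (a ∷ b ∷ cs)

restart-reduct : ℕ → Tm → Tm → List Tm → Tm
restart-reduct zero    a b cs = apps b cs
restart-reduct (suc l) a b cs = apps (app a (app (app (Xc l a b cs) a) b)) cs

restart-⟶w* : ∀ l a b cs → restart l a b cs ⟶w* restart-reduct l a b cs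
restart-⟶w* zero    a b cs = ⟶w*-apps cs (church-⟶w* 0 a b)
restart-⟶w* (suc l) a b cs =
  ⟶w-apps (a ∷ b ∷ cs) β ◅ ⟶w-apps (b ∷ cs) β ◅ ⟶w-apps cs last ◅ ε
  where
  ν = Xc l a b cs
  body = app (shift 0 a) (app (app ν (shift 0 a)) (var 0))
  last : app (lam body) b ⟶w app a (app (app ν a) b)
  last = transport (λ a′ → app (lam body) b ⟶w app a′ (app (app ν a′) b))
                   (subst-shift-cancel 0 b a) β

data Call (n : ℕ) : Tm → Tm → Set where
  X-call  : ∀ {l a b cs} → n ≡ l → Call n (apps (X n) (a ∷ b ∷ cs)) (restart l a b cs)
  Xc-call : ∀ {l a b cs A B rest} → l < n →
            Call n (apps (Xc l a b cs) (A ∷ B ∷ rest)) (restart l A B rest)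

Next⇒Call : ∀ {n V U} → Next S₁ n V U → Call n V U
Next⇒Call (x-zero {a} {b} {cs} n≡0)       = X-call {a = a} {b} {cs} n≡0
Next⇒Call (x-suc {m} {a} {b} {cs} n≡1+m)  = X-call {a = a} {b} {cs} n≡1+m
Next⇒Call (c-zero {a} {b} {cs} {u} {v} {ws} 0<n) =
  Xc-call {a = a} {b} {cs} {u} {v} {ws} 0<n
Next⇒Call (c-suc {l} {a} {b} {cs} {u} {v} {ws} 1+l<n) =
  Xc-call {a = a} {b} {cs} {u} {v} {ws} 1+l<n

Call⇒Next : ∀ {n V U} → Call n V U → Next S₁ n V U
Call⇒Next (X-call {zero}  {a} {b} {cs} n≡0)   = x-zero {a = a} {b} {cs} n≡0
Call⇒Next (X-call {suc m} {a} {b} {cs} n≡1+m) = x-suc {a = a} {b} {cs} n≡1+m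
Call⇒Next (Xc-call {zero}  {a} {b} {cs} {A} {B} {rest} 0<n) =
  c-zero {a = a} {b} {cs} {A} {B} {rest} 0<n
Call⇒Next (Xc-call {suc l} {a} {b} {cs} {A} {B} {rest} 1+l<n) =
  c-suc {a = a} {b} {cs} {A} {B} {rest} 1+l<n

-- Church–Rosser

infix 4 _⟶β*_ _⇛_ _⇛*_

_⟶β*_ : Tm → Tm → Set
_⟶β*_ = Star _⟶β_

data _⇛_ : Tm → Tm → Set where
  var : ∀ {i} → var i ⇛ var i
  X   : ∀ {i} → X i ⇛ X i
  Xc  : ∀ {l a b cs} → Xc l a b cs ⇛ Xc l a b cs
  lam : ∀ {t t′} → t ⇛ t′ → lam t ⇛ lam t′
  app : ∀ {t t′ u u′} → t ⇛ t′ → u ⇛ u′ → app t u ⇛ app t′ u′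
  β   : ∀ {t t′ u u′} → t ⇛ t′ → u ⇛ u′ → app (lam t) u ⇛ subst 0 u′ t′

_⇛*_ : Tm → Tm → Set
_⇛*_ = Star _⇛_

⇛-refl : ∀ t → t ⇛ t
⇛-refl (var i)       = var
⇛-refl (lam t)       = lam (⇛-refl t)
⇛-refl (app t u)     = app (⇛-refl t) (⇛-refl u)
⇛-refl (X i)         = X
⇛-refl (Xc l a b cs) = Xc

⇛-shift : ∀ c {t t′} → t ⇛ t′ → shift c t ⇛ shift c t′
⇛-shift c (var {i}) = ⇛-refl (shift c (var i))
⇛-shift c X         = X
⇛-shift c Xc        = Xc
⇛-shift c (lam p)   = lam (⇛-shift (suc c) p)
⇛-shift c (app p q) = app (⇛-shift c p) (⇛-shift c q)
⇛-shift c (β {t′ = t′} {u′ = u′} p q) rewrite shift-subst-above 0 c u′ t′ z≤n =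
  β (⇛-shift (suc c) p) (⇛-shift c q)

⇛-subst : ∀ k {t t′ v v′} → t ⇛ t′ → v ⇛ v′ → subst k v t ⇛ subst k v′ t′
⇛-subst k (var {i}) q with i <ᵇ k | i ≡ᵇ k
... | true  | _     = var
... | false | true  = q
... | false | false = var
⇛-subst k X         q = X
⇛-subst k Xc        q = Xc
⇛-subst k (lam p)   q = lam (⇛-subst (suc k) p (⇛-shift 0 q))
⇛-subst k (app p p′) q = app (⇛-subst k p q) (⇛-subst k p′ q)
⇛-subst k {v′ = v′} (β {t′ = t′} {u′ = u′} p p′) q rewrite subst-subst-comm 0 k v′ u′ t′ z≤n =
  β (⇛-subst (suc k) p (⇛-shift 0 q)) (⇛-subst k p′ q)

develop : Tm → Tm
develop (var i)         = var i
develop (lam t)         = lam (develop t)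
develop (app (lam t) u) = subst 0 (develop u) (develop t)
develop (app t u)       = app (develop t) (develop u)
develop (X i)           = X i
develop (Xc l a b cs)   = Xc l a b cs

⇛-develop : ∀ {t t′} → t ⇛ t′ → t′ ⇛ develop t
⇛-develop var                  = var
⇛-develop X                    = X
⇛-develop Xc                   = Xc
⇛-develop (lam p)              = lam (⇛-develop p)
⇛-develop (app (lam p) q)      = β (⇛-develop p) (⇛-develop q)
⇛-develop (app var q)          = app var (⇛-develop q)
⇛-develop (app X q)            = app X (⇛-develop q)
⇛-develop (app Xc q)           = app Xc (⇛-develop q)
⇛-develop (app (app p p′) q)   = app (⇛-develop (app p p′)) (⇛-develop q)
⇛-develop (app (β p p′) q)     = app (⇛-develop (β p p′)) (⇛-develop q)
⇛-develop (β p q)              = ⇛-subst 0 (⇛-develop p) (⇛-develop q)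

⇛-strip : ∀ {a b c} → a ⇛ b → a ⇛* c → ∃ λ d → b ⇛* d × c ⇛ d
⇛-strip p ε        = _ , ε , p
⇛-strip p (q ◅ qs) with ⇛-strip (⇛-develop q) qs
... | d , ps , r = d , ⇛-develop p ◅ ps , r

⟶β⇒⇛ : ∀ {t t′} → t ⟶β t′ → t ⇛ t′
⟶β⇒⇛ (β {u} {v})       = β (⇛-refl u) (⇛-refl v)
⟶β⇒⇛ (lamβ r)          = lam (⟶β⇒⇛ r)
⟶β⇒⇛ (appl {u = u} r)  = app (⟶β⇒⇛ r) (⇛-refl u)
⟶β⇒⇛ (appr {t = t} r)  = app (⇛-refl t) (⟶β⇒⇛ r)

⇛⇒⟶β* : ∀ {t t′} → t ⇛ t′ → t ⟶β* t′
⇛⇒⟶β* var = ε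
⇛⇒⟶β* X   = ε
⇛⇒⟶β* Xc  = ε
⇛⇒⟶β* (lam p) = gmap lam lamβ (⇛⇒⟶β* p)
⇛⇒⟶β* (app {t′ = t′} {u = u} p q) =
  gmap (λ t → app t u) appl (⇛⇒⟶β* p) ◅◅ gmap (app t′) appr (⇛⇒⟶β* q)
⇛⇒⟶β* (β {t′ = t′} {u = u} p q) =
  gmap (λ t → app (lam t) u) (λ r → appl (lamβ r)) (⇛⇒⟶β* p) ◅◅
  gmap (app (lam t′)) appr (⇛⇒⟶β* q) ◅◅ β ◅ ε

⇛*⇒⟶β* : ∀ {t t′} → t ⇛* t′ → t ⟶β* t′
⇛*⇒⟶β* ε        = ε
⇛*⇒⟶β* (p ◅ ps) = ⇛⇒⟶β* p ◅◅ ⇛*⇒⟶β* ps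

≃β-join : ∀ {a b} → a ≃β b → ∃ λ c → a ⇛* c × b ⇛* c
≃β-join ε = _ , ε , ε
≃β-join (fwd r ◅ rs) with ≃β-join rs
... | c , p , q = c , ⟶β⇒⇛ r ◅ p , q
≃β-join (bwd r ◅ rs) with ≃β-join rs
... | c , p , q with ⇛-strip (⟶β⇒⇛ r) p
...   | d , p′ , s = d , p′ , q ◅◅ s ◅ ε

iter-⇛ : ∀ l {t} → iter l (app (var 1)) (var 0) ⇛ t → t ≡ iter l (app (var 1)) (var 0)
iter-⇛ zero    var         = refl
iter-⇛ (suc l) (app var p) = cong (app (var 1)) (iter-⇛ l p)

church-⇛* : ∀ n {t} → church n ⇛* t → t ≡ church n
church-⇛* n ε = refl
church-⇛* n (lam (lam p) ◅ ps) rewrite iter-⇛ n p = church-⇛* n ps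

≃β-church⇒⟶β* : ∀ {n θ} → θ ≃β church n → θ ⟶β* church n
≃β-church⇒⟶β* {n} θ≃n with ≃β-join θ≃n
... | c , θ⇛*c , n⇛*c rewrite church-⇛* n n⇛*c = ⇛*⇒⟶β* θ⇛*c

-- Standardisation

infix 4 _↠ₛ_

data _↠ₛ_ : Tm → Tm → Set where
  var : ∀ {M i} → M ⟶w* var i → M ↠ₛ var i
  X   : ∀ {M i} → M ⟶w* X i → M ↠ₛ X i
  Xc  : ∀ {M l a b cs} → M ⟶w* Xc l a b cs → M ↠ₛ Xc l a b cs
  app : ∀ {M P Q P′ Q′} → M ⟶w* app P Q → P ↠ₛ P′ → Q ↠ₛ Q′ → M ↠ₛ app P′ Q′
  lam : ∀ {M P P′} → M ⟶w* lam P → P ↠ₛ P′ → M ↠ₛ lam P′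

⟶w*-↠ₛ : ∀ {M M′ N} → M ⟶w* M′ → M′ ↠ₛ N → M ↠ₛ N
⟶w*-↠ₛ r (var r′)     = var (r ◅◅ r′)
⟶w*-↠ₛ r (X r′)       = X (r ◅◅ r′)
⟶w*-↠ₛ r (Xc r′)      = Xc (r ◅◅ r′)
⟶w*-↠ₛ r (app r′ p q) = app (r ◅◅ r′) p q
⟶w*-↠ₛ r (lam r′ p)   = lam (r ◅◅ r′) p

↠ₛ-refl : ∀ t → t ↠ₛ t
↠ₛ-refl (var i)       = var ε
↠ₛ-refl (lam t)       = lam ε (↠ₛ-refl t)
↠ₛ-refl (app t u)     = app ε (↠ₛ-refl t) (↠ₛ-refl u)
↠ₛ-refl (X i)         = X ε
↠ₛ-refl (Xc l a b cs) = Xc ε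

↠ₛ-shift : ∀ c {M N} → M ↠ₛ N → shift c M ↠ₛ shift c N
↠ₛ-shift c (var {i = i} r) = shift-var (⟶w*-shift c r)
  where
  shift-var : ∀ {M} → M ⟶w* shift c (var i) → M ↠ₛ shift c (var i)
  shift-var r with i <ᵇ c
  ... | true  = var r
  ... | false = var r
↠ₛ-shift c (X r)       = X (⟶w*-shift c r)
↠ₛ-shift c (Xc r)      = Xc (⟶w*-shift c r)
↠ₛ-shift c (app r p q) = app (⟶w*-shift c r) (↠ₛ-shift c p) (↠ₛ-shift c q)
↠ₛ-shift c (lam r p)   = lam (⟶w*-shift c r) (↠ₛ-shift (suc c) p)

↠ₛ-subst : ∀ k {M M′ N N′} → M ↠ₛ M′ → N ↠ₛ N′ → subst k N M ↠ₛ subst k N′ M′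
↠ₛ-subst k {N = N} {N′} (var {i = i} r) q = subst-var (⟶w*-subst k N r)
  where
  subst-var : ∀ {M} → M ⟶w* subst k N (var i) → M ↠ₛ subst k N′ (var i)
  subst-var r with i <ᵇ k | i ≡ᵇ k
  ... | true  | _     = var r
  ... | false | true  = ⟶w*-↠ₛ r q
  ... | false | false = var r
↠ₛ-subst k {N = N} (X r)       q = X (⟶w*-subst k N r)
↠ₛ-subst k {N = N} (Xc r)      q = Xc (⟶w*-subst k N r)
↠ₛ-subst k {N = N} (app r p p′) q = app (⟶w*-subst k N r) (↠ₛ-subst k p q) (↠ₛ-subst k p′ q)
↠ₛ-subst k {N = N} (lam r p)   q = lam (⟶w*-subst k N r) (↠ₛ-subst (suc k) p (↠ₛ-shift 0 q))

↠ₛ-⟶β : ∀ {M N N′} → M ↠ₛ N → N ⟶β N′ → M ↠ₛ N′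
↠ₛ-⟶β (app r (lam r′ p) q) β = ⟶w*-↠ₛ (r ◅◅ ⟶w*-appl r′) (⟶w*-↠ₛ (β ◅ ε) (↠ₛ-subst 0 p q))
↠ₛ-⟶β (lam r p)   (lamβ s) = lam r (↠ₛ-⟶β p s)
↠ₛ-⟶β (app r p q) (appl s) = app r (↠ₛ-⟶β p s) q
↠ₛ-⟶β (app r p q) (appr s) = app r p (↠ₛ-⟶β q s)

↠ₛ-⟶β* : ∀ {M N N′} → M ↠ₛ N → N ⟶β* N′ → M ↠ₛ N′
↠ₛ-⟶β* p ε        = p
↠ₛ-⟶β* p (s ◅ ss) = ↠ₛ-⟶β* (↠ₛ-⟶β p s) ss

-- Unfolds l a b R: R behaves as (a)^l b under weak head reduction, one layer at a time.
Unfolds : ℕ → Tm → Tm → Tm → Set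
Unfolds zero    a b R = R ⟶w* b
Unfolds (suc l) a b R = ∃ λ R′ → R ⟶w* app a R′ × Unfolds l a b R′

Unfolds-shift : ∀ {l a b R} c → Unfolds l a b R → Unfolds l (shift c a) (shift c b) (shift c R)
Unfolds-shift {zero}  c r            = ⟶w*-shift c r
Unfolds-shift {suc l} c (R′ , r , u) = shift c R′ , ⟶w*-shift c r , Unfolds-shift {l} c u

Unfolds-subst : ∀ {l a b R} k s → Unfolds l a b R → Unfolds l (subst k s a) (subst k s b) (subst k s R)
Unfolds-subst {zero}  k s r            = ⟶w*-subst k s r
Unfolds-subst {suc l} k s (R′ , r , u) = subst k s R′ , ⟶w*-subst k s r , Unfolds-subst {l} k s u

⟶w*-Unfolds : ∀ l {a b R R′} → R ⟶w* R′ → Unfolds l a b R′ → Unfolds l a b R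
⟶w*-Unfolds zero    r r′            = r ◅◅ r′
⟶w*-Unfolds (suc l) r (R″ , r′ , u) = R″ , r ◅◅ r′ , u

↠ₛ-iter⇒Unfolds : ∀ l {a b P} → P ↠ₛ iter l (app (var 1)) (var 0) →
  Unfolds l a b (subst 0 b (subst 1 (shift 0 a) P))
↠ₛ-iter⇒Unfolds zero    {a} {b} (var r) = ⟶w*-subst 0 b (⟶w*-subst 1 (shift 0 a) r)
↠ₛ-iter⇒Unfolds (suc l) {a} {b} {P} (app {Q = Q} r (var r′) q) =
  σ Q , transport (λ a′ → σ P ⟶w* app a′ (σ Q)) (subst-shift-cancel 0 b a)
                  (⟶w*-subst 0 b (⟶w*-subst 1 (shift 0 a) (r ◅◅ ⟶w*-appl r′))) ,
  ↠ₛ-iter⇒Unfolds l q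
  where
  σ : Tm → Tm
  σ t = subst 0 b (subst 1 (shift 0 a) t)

↠ₛ-church⇒Unfolds : ∀ n {θ} → θ ↠ₛ church n → ∀ a b → Unfolds n a b (app (app θ a) b)
↠ₛ-church⇒Unfolds n {θ} (lam r₁ (lam {P = P} r₂ p)) a b =
  ⟶w*-Unfolds n head-steps (↠ₛ-iter⇒Unfolds n p)
  where
  head-steps : app (app θ a) b ⟶w* subst 0 b (subst 1 (shift 0 a) P)
  head-steps = ⟶w*-appl (⟶w*-appl r₁) ◅◅ appl β ◅ ⟶w*-appl (⟶w*-subst 0 a r₂) ◅◅ β ◅ ε

-- Church–Rosser turns θ ≃β n into θ ⟶β* n, and standardisation turns that into head reductions.
≃β-church⇒Unfolds : ∀ {n θ} → θ ≃β church n → ∀ a b → Unfolds n a b (app (app θ a) b)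
≃β-church⇒Unfolds {n} {θ} θ≃n =
  ↠ₛ-church⇒Unfolds n (↠ₛ-⟶β* (↠ₛ-refl θ) (≃β-church⇒⟶β* {n} θ≃n))

-- Simulating λX-terms

data PartialPair : Tm → Set where
  Xc  : ∀ {l a b cs} → PartialPair (Xc l a b cs)
  Xc· : ∀ {l a b cs A} → PartialPair (app (Xc l a b cs) A)

¬PartialPair-app : ∀ {t u} → ¬ PartialPair t → ¬ PartialPair (app t u)
¬PartialPair-app ¬pp Xc· = ¬pp Xc

-- M ~ R: R is M with X_n replaced by θ and every (X_{l,…}) A B replaced by a term that Pair
-- declares to stand for (l) A B.
module Simulation (n : ℕ) (θ : Tm) (θ-closed : ClosedΛ θ)
  (Pair : ℕ → Tm → Tm → Tm → Set)
  (Pair-shift : ∀ {l A B R} c → Pair l A B R → Pair l (shift c A) (shift c B) (shift c R))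
  (Pair-subst : ∀ {l A B R} k s → Pair l A B R → Pair l (subst k s A) (subst k s B) (subst k s R))
  where

  infix 4 _~_ _~*_

  data _~_ : Tm → Tm → Set where
    var  : ∀ i → var i ~ var i
    lam  : ∀ {t t′} → t ~ t′ → lam t ~ lam t′
    app  : ∀ {t t′ u u′} → t ~ t′ → u ~ u′ → app t u ~ app t′ u′
    X    : X n ~ θ
    pair : ∀ {l a b cs A B A′ B′ R} → l < n → A ~ A′ → B ~ B′ → Pair l A′ B′ R →
           app (app (Xc l a b cs) A) B ~ R

  _~*_ : List Tm → List Tm → Set
  _~*_ = Pointwise _~_

  ~-apps : ∀ {t t′ args args′} → t ~ t′ → args ~* args′ → apps t args ~ apps t′ args′
  ~-apps p []       = p
  ~-apps p (q ∷ qs) = ~-apps (app p q) qs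

  ~-shift : ∀ c {t t′} → t ~ t′ → shift c t ~ shift c t′
  ~-shift c (var i) with i <ᵇ c
  ... | true  = var i
  ... | false = var (suc i)
  ~-shift c (lam p)              = lam (~-shift (suc c) p)
  ~-shift c (app p q)            = app (~-shift c p) (~-shift c q)
  ~-shift c X                    = transport (X n ~_) (sym (WS⇒shift-id θ-closed z≤n)) X
  ~-shift c (pair l<n p q pr)    = pair l<n (~-shift c p) (~-shift c q) (Pair-shift c pr)

  ~-subst : ∀ k {t t′ v v′} → t ~ t′ → v ~ v′ → subst k v t ~ subst k v′ t′
  ~-subst k (var i) q with i <ᵇ k | i ≡ᵇ k
  ... | true  | _     = var i
  ... | false | true  = q
  ... | false | false = var (pred i)
  ~-subst k (lam p)           q = lam (~-subst (suc k) p (~-shift 0 q))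
  ~-subst k (app p p′)        q = app (~-subst k p q) (~-subst k p′ q)
  ~-subst k X                 q = transport (X n ~_) (sym (WS⇒subst-id θ-closed z≤n)) X
  ~-subst k {v′ = v′} (pair l<n p p′ pr) q =
    pair l<n (~-subst k p q) (~-subst k p′ q) (Pair-subst k v′ pr)

  ~-⟶w : ∀ {M R N} → M ~ R → M ⟶w N → ∃ λ R′ → R ⟶w R′ × N ~ R′
  ~-⟶w (app (lam p) q) β        = _ , β , ~-subst 0 p q
  ~-⟶w (app p q)       (appl r) with ~-⟶w p r
  ... | _ , r′ , p′ = _ , appl r′ , app p′ q
  ~-⟶w (pair _ _ _ _)  (appl (appl ()))

  ~-⟶w* : ∀ {M R N} → M ~ R → M ⟶w* N → ∃ λ R′ → R ⟶w* R′ × N ~ R′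
  ~-⟶w* p ε        = _ , ε , p
  ~-⟶w* p (r ◅ rs) with ~-⟶w p r
  ... | _ , r′ , p′ with ~-⟶w* p′ rs
  ...   | _ , rs′ , p″ = _ , r′ ◅ rs′ , p″

  data Spine : Tm → Set where
    X-spine  : ∀ args → Spine (apps (X n) args)
    Xc-spine : ∀ l a b cs A B rest → Spine (apps (Xc l a b cs) (A ∷ B ∷ rest))

  Spine-app : ∀ {t} u → Spine t → Spine (app t u)
  Spine-app u (X-spine args) = transport Spine (apps-∷ʳ (X n) args u) (X-spine (args ∷ʳ u))
  Spine-app u (Xc-spine l a b cs A B rest) =
    transport Spine (apps-∷ʳ (Xc l a b cs) (A ∷ B ∷ rest) u) (Xc-spine l a b cs A B (rest ∷ʳ u))

  ~-⟶w⁻¹ : ∀ {M R R′} → M ~ R → R ⟶w R′ → (∃ λ N → M ⟶w N × N ~ R′) ⊎ Spine M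
  ~-⟶w⁻¹ X                                               _ = inj₂ (X-spine [])
  ~-⟶w⁻¹ (pair {l} {a} {b} {cs} {A} {B} _ _ _ _)         _ = inj₂ (Xc-spine l a b cs A B [])
  ~-⟶w⁻¹ (app X _)                                       _ = inj₂ (X-spine (_ ∷ []))
  ~-⟶w⁻¹ (app (pair {l} {a} {b} {cs} {A} {B} _ _ _ _) _) _ = inj₂ (Xc-spine l a b cs A B (_ ∷ []))
  ~-⟶w⁻¹ (app (lam p) q) β = inj₁ (_ , β , ~-subst 0 p q)
  ~-⟶w⁻¹ (app p q) (appl r) with ~-⟶w⁻¹ p r
  ... | inj₁ (_ , m , p′) = inj₁ (_ , appl m , app p′ q)
  ... | inj₂ sp           = inj₂ (Spine-app _ sp)

  data AppsImage (t : Tm) (args : List Tm) : Tm → Set where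
    image : ∀ {R args′} → t ~ R → args ~* args′ → AppsImage t args (apps R args′)

  ~-apps⁻¹ : ∀ {t R} args → ¬ PartialPair t → apps t args ~ R → AppsImage t args R
  ~-apps⁻¹ []       _   p = image p []
  ~-apps⁻¹ (u ∷ us) ¬pp p with ~-apps⁻¹ us (¬PartialPair-app ¬pp) p
  ... | image (app q r) qs     = image q (r ∷ qs)
  ... | image (pair _ _ _ _) _ = ⊥-elim (¬pp Xc·)

  WS⇒~-refl : ∀ {k t} → WS k t → t ~ t
  WS⇒~-refl (var {i} _) = var i
  WS⇒~-refl (lam w)     = lam (WS⇒~-refl w)
  WS⇒~-refl (app w v)   = app (WS⇒~-refl w) (WS⇒~-refl v)

  WS⇒~-unique : ∀ {k t R} → WS k t → t ~ R → R ≡ t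
  WS⇒~-unique (var _)   (var _)    = refl
  WS⇒~-unique (lam w)   (lam p)    = cong lam (WS⇒~-unique w p)
  WS⇒~-unique (app w v) (app p q)  = cong₂ app (WS⇒~-unique w p) (WS⇒~-unique v q)
  WS⇒~-unique (app (app () _) _) (pair _ _ _ _)

  Unfolding : ℕ → Tm → Tm → Tm → Set
  Unfolding zero    A B T = T ≡ B
  Unfolding (suc l) A B T = ∃ λ R → T ≡ app A R × Pair l A B R

  restart-~ : ∀ l {A B rest A′ B′ rest′ T} → l ≤ n → A ~ A′ → B ~ B′ → rest ~* rest′ →
    Unfolding l A′ B′ T → restart-reduct l A B rest ~ apps T rest′
  restart-~ zero    _   _  qB qs refl             = ~-apps qB qs
  restart-~ (suc m) m<n qA qB qs (_ , refl , pr) = ~-apps (app qA (pair m<n qA qB pr)) qs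

-- S₁-storage operators are storage operators

final-τ : ∀ {S n U} → Reaches S n U → Tm
final-τ (final τ _ _ _) = τ
final-τ (step _ _ r)    = final-τ r

final-τ-closed : ∀ {S n U} (r : Reaches S n U) → ClosedΛ (final-τ r)
final-τ-closed (final _ _ τ-closed _) = τ-closed
final-τ-closed (step _ _ r)           = final-τ-closed r

final-τ-≃β : ∀ {S n U} (r : Reaches S n U) → final-τ r ≃β church n
final-τ-≃β (final _ _ _ τ≃n) = τ≃n
final-τ-≃β (step _ _ r)      = final-τ-≃β r

≻-Reaches : ∀ {S n U U′} → U ≻ U′ → Reaches S n U′ → Reaches S n U
≻-Reaches h (final τ h′ τ-closed τ≃n) = final τ (h ◅◅ h′) τ-closed τ≃n
≻-Reaches h (step h′ next r)          = step (h ◅◅ h′) next r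

module ReplayWithNumeral (n : ℕ) (θ : Tm) (θ-closed : ClosedΛ θ)
  (θ-unfolds : ∀ a b → Unfolds n a b (app (app θ a) b)) where

  open Simulation n θ θ-closed Unfolds Unfolds-shift Unfolds-subst

  Unfolds⇒Unfolding : ∀ l {A B R} → Unfolds l A B R → ∃ λ T → R ⟶w* T × Unfolding l A B T
  Unfolds⇒Unfolding zero    r            = _ , r , refl
  Unfolds⇒Unfolding (suc l) (R′ , r , u) = _ , r , R′ , refl , u

  follow : ∀ {U W R V} → U ⟶w* W → W ~ R → U ≻ V → Neutral V → ∃ λ R′ → R ⟶w* R′ × V ~ R′
  follow U⟶W p U≻V V-ne =
    ~-⟶w* p (proj₁ (⟶w*-toward-WhNF U⟶W (≻-Neutral⇒⟶w* U≻V V-ne) (Neutral⇒WhNF V-ne)))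

  mutual
    replay : ∀ {U W R} (r : Reaches S₁ n U) → U ⟶w* W → W ~ R → R ≻ app fv (final-τ r)
    replay (final τ U≻fτ τ-closed _) U⟶W p with follow U⟶W p U≻fτ (app var)
    ... | _ , R⟶R′ , q with WS⇒~-unique {1} (app (var (s≤s z≤n)) (WS-weaken τ-closed z≤n)) q
    ...   | refl = ⟶w*⇒≻ R⟶R′
    replay (step U≻V next r) U⟶W p = replay-call (Next⇒Call next) U≻V r U⟶W p

    replay-call : ∀ {U V U′ W R} → Call n V U′ → U ≻ V → (r : Reaches S₁ n U′) →
      U ⟶w* W → W ~ R → R ≻ app fv (final-τ r)
    replay-call (X-call {l} {a} {b} {cs} n≡l) U≻V r U⟶W p
      with follow U⟶W p U≻V (Neutral-apps (a ∷ b ∷ cs) X)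
    ... | _ , R⟶R′ , q with ~-apps⁻¹ (a ∷ b ∷ cs) (λ ()) q
    ...   | image X (qa ∷ qb ∷ qs) =
      ⟶w*⇒≻ R⟶R′ ◅◅ resume l (≤-reflexive (sym n≡l)) r qa qb qs
                              (transport (λ k → Unfolds k _ _ _) n≡l (θ-unfolds _ _))
    replay-call (Xc-call {l} {a} {b} {cs} {A} {B} {rest} l<n) U≻V r U⟶W p
      with follow U⟶W p U≻V (Neutral-apps (A ∷ B ∷ rest) Xc)
    ... | _ , R⟶R′ , q with ~-apps⁻¹ rest (λ ()) q
    ...   | image (pair _ qA qB u) qs     = ⟶w*⇒≻ R⟶R′ ◅◅ resume l (<⇒≤ l<n) r qA qB qs u
    ...   | image (app (app () _) _) _

    resume : ∀ l {A B rest A′ B′ rest′ R} → l ≤ n → (r : Reaches S₁ n (restart l A B rest)) →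
      A ~ A′ → B ~ B′ → rest ~* rest′ → Unfolds l A′ B′ R → apps R rest′ ≻ app fv (final-τ r)
    resume l {A} {B} {rest} {rest′ = rest′} l≤n r qA qB qs u with Unfolds⇒Unfolding l u
    ... | _ , R⟶T , T-unf =
      ⟶w*⇒≻ (⟶w*-apps rest′ R⟶T) ◅◅
      replay r (restart-⟶w* l A B rest) (restart-~ l l≤n qA qB qs T-unf)

  replay-storage : ∀ {T} → ClosedΛ T → (r : Reaches S₁ n (app (app T (X n)) fv)) →
    app (app T θ) fv ≻ app fv (final-τ r)
  replay-storage T-closed r = replay r ε (app (app (WS⇒~-refl T-closed) X) (var 0))

SStorage⇒Storage : ∀ T → ClosedΛ T → SStorageOperator S₁ T → StorageOperator T
SStorage⇒Storage T T-closed T-stores n =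
  final-τ r , final-τ-closed r , final-τ-≃β r ,
  λ θ θ-closed θ≃n →
    ReplayWithNumeral.replay-storage n θ θ-closed (≃β-church⇒Unfolds θ≃n) T-closed r
  where
  r = T-stores n

-- Storage operators are S₁-storage operators

I : Tm
I = lam (var 0)

mutual
  iterᴵ : ℕ → Tm → Tm → Tm
  iterᴵ l a b = app I (iterᴵ-body l a b)

  iterᴵ-body : ℕ → Tm → Tm → Tm
  iterᴵ-body zero    a b = b
  iterᴵ-body (suc l) a b = app a (iterᴵ l a b)

iterᴵ-⟶w : ∀ l a b → iterᴵ l a b ⟶w iterᴵ-body l a b
iterᴵ-⟶w l a b = β

churchᴵ : ℕ → Tm
churchᴵ n = lam (lam (iterᴵ n (var 1) (var 0)))

iterᴵ-hom : (f : Tm → Tm) → (∀ {t u} → f (app t u) ≡ app (f t) (f u)) → f I ≡ I →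
  ∀ l A B → f (iterᴵ l A B) ≡ iterᴵ l (f A) (f B)
iterᴵ-hom f f-app f-I l A B = trans f-app (cong₂ app f-I (body l))
  where
  body : ∀ l → f (iterᴵ-body l A B) ≡ iterᴵ-body l (f A) (f B)
  body zero    = refl
  body (suc l) = trans f-app (cong (app (f A)) (iterᴵ-hom f f-app f-I l A B))

WS-iterᴵ : ∀ {k} l {A B} → WS k A → WS k B → WS k (iterᴵ l A B)
WS-iterᴵ {k} l {A} {B} A-ws B-ws = app (lam (var (s≤s z≤n))) (body l)
  where
  body : ∀ l → WS k (iterᴵ-body l A B)
  body zero    = B-ws
  body (suc l) = app A-ws (WS-iterᴵ l A-ws B-ws)

churchᴵ-closed : ∀ n → ClosedΛ (churchᴵ n)
churchᴵ-closed n = lam (lam (WS-iterᴵ n (var (s≤s (s≤s z≤n))) (var (s≤s z≤n))))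

iterᴵ-⟶β*-iter : ∀ l a b → iterᴵ l a b ⟶β* iter l (app a) b
iterᴵ-⟶β*-iter zero    a b = β ◅ ε
iterᴵ-⟶β*-iter (suc l) a b = β ◅ gmap (app a) appr (iterᴵ-⟶β*-iter l a b)

churchᴵ≃church : ∀ n → churchᴵ n ≃β church n
churchᴵ≃church n = gmap id fwd (gmap lam lamβ (gmap lam lamβ (iterᴵ-⟶β*-iter n (var 1) (var 0))))

churchᴵ-⟶w* : ∀ l a b → app (app (churchᴵ l) a) b ⟶w* iterᴵ l a b
churchᴵ-⟶w* l a b = transport (app (app (churchᴵ l) a) b ⟶w*_) reduct (appl β ◅ β ◅ ε)
  where
  open ≡-Reasoning
  reduct : subst 0 b (subst 1 (shift 0 a) (iterᴵ l (var 1) (var 0))) ≡ iterᴵ l a b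
  reduct = begin
    subst 0 b (subst 1 (shift 0 a) (iterᴵ l (var 1) (var 0)))
      ≡⟨ cong (subst 0 b) (iterᴵ-hom (subst 1 (shift 0 a)) refl refl l (var 1) (var 0)) ⟩
    subst 0 b (iterᴵ l (shift 0 a) (var 0))
      ≡⟨ iterᴵ-hom (subst 0 b) refl refl l (shift 0 a) (var 0) ⟩
    iterᴵ l (subst 0 b (shift 0 a)) b
      ≡⟨ cong (λ a′ → iterᴵ l a′ b) (subst-shift-cancel 0 b a) ⟩
    iterᴵ l a b
      ∎

data IsIter (l : ℕ) (A B : Tm) : Tm → Set where
  is-iter : IsIter l A B (iter l (app A) B)

IsIter-shift : ∀ {l A B R} c → IsIter l A B R → IsIter l (shift c A) (shift c B) (shift c R)
IsIter-shift {l} {A} {B} c is-iter =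
  transport (IsIter l (shift c A) (shift c B)) (sym (iter-hom (shift c) refl l A B)) is-iter

IsIter-subst : ∀ {l A B R} k s → IsIter l A B R → IsIter l (subst k s A) (subst k s B) (subst k s R)
IsIter-subst {l} {A} {B} k s is-iter =
  transport (IsIter l (subst k s A) (subst k s B)) (sym (iter-hom (subst k s) refl l A B)) is-iter

data IsIterᴵ (l : ℕ) (A B : Tm) : Tm → Set where
  is-iterᴵ : IsIterᴵ l A B (iterᴵ l A B)

IsIterᴵ-shift : ∀ {l A B R} c → IsIterᴵ l A B R → IsIterᴵ l (shift c A) (shift c B) (shift c R)
IsIterᴵ-shift {l} {A} {B} c is-iterᴵ =
  transport (IsIterᴵ l (shift c A) (shift c B)) (sym (iterᴵ-hom (shift c) refl refl l A B)) is-iterᴵ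

IsIterᴵ-subst : ∀ {l A B R} k s → IsIterᴵ l A B R → IsIterᴵ l (subst k s A) (subst k s B) (subst k s R)
IsIterᴵ-subst {l} {A} {B} k s is-iterᴵ =
  transport (IsIterᴵ l (subst k s A) (subst k s B)) (sym (iterᴵ-hom (subst k s) refl refl l A B)) is-iterᴵ

size : Tm → ℕ
size (var i)       = 1
size (lam t)       = suc (size t)
size (app t u)     = suc (size t + size u)
size (X i)         = 1
size (Xc l a b cs) = 1

size-iter<iterᴵ : ∀ l {A B A′ B′} → size A ≤ size A′ → size B ≤ size B′ →
  size (iter l (app A) B) < size (iterᴵ l A′ B′)
size-iter<iterᴵ zero    A≤ B≤ = s≤s (m≤n⇒m≤1+n (m≤n⇒m≤1+n B≤))
size-iter<iterᴵ (suc l) A≤ B≤ =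
  s≤s (s≤s (m≤n⇒m≤1+n (m≤n⇒m≤1+n (+-mono-≤ A≤ (<⇒≤ (size-iter<iterᴵ l A≤ B≤))))))

module ReplayAgainstStorage (n : ℕ) (τ : Tm) (τ-closed : ClosedΛ τ) (τ≃n : τ ≃β church n) where

  module C = Simulation n (church n) (church-closed n) IsIter IsIter-shift IsIter-subst
  module P = Simulation n (churchᴵ n) (churchᴵ-closed n) IsIterᴵ IsIterᴵ-shift IsIterᴵ-subst

  G : Tm
  G = app fv τ

  G-WhNF : WhNF G
  G-WhNF = Neutral⇒WhNF (app var)

  iter-Unfolding : ∀ l {A B} → C.Unfolding l A B (iter l (app A) B)
  iter-Unfolding zero    = refl
  iter-Unfolding (suc l) = _ , refl , is-iter

  iterᴵ-body-Unfolding : ∀ l {A B} → P.Unfolding l A B (iterᴵ-body l A B)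
  iterᴵ-body-Unfolding zero    = refl
  iterᴵ-body-Unfolding (suc l) = _ , refl , is-iterᴵ

  size-C≤P : ∀ {M R Rᴵ} → M C.~ R → M P.~ Rᴵ → size R ≤ size Rᴵ
  size-C≤P (C.var i)   (P.var .i)   = ≤-refl
  size-C≤P (C.lam p)   (P.lam q)    = s≤s (size-C≤P p q)
  size-C≤P (C.app p p′) (P.app q q′) = s≤s (+-mono-≤ (size-C≤P p q) (size-C≤P p′ q′))
  size-C≤P (C.app (C.app () _) _) (P.pair _ _ _ _)
  size-C≤P (C.pair _ _ _ _) (P.app (P.app () _) _)
  size-C≤P C.X P.X = <⇒≤ (s≤s (s≤s (size-iter<iterᴵ n {var 1} {var 0} ≤-refl ≤-refl)))
  size-C≤P (C.pair _ pA pB is-iter) (P.pair _ qA qB is-iterᴵ) =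
    <⇒≤ (size-iter<iterᴵ _ (size-C≤P pA qA) (size-C≤P pB qB))

  -- Both images of X_n and of every pair are strictly smaller under C than under P,
  -- so equal images force M to be free of constants.
  images-agree : ∀ {M R Rᴵ} → M C.~ R → M P.~ Rᴵ → R ≡ Rᴵ → M ≡ R
  images-agree (C.var i)    (P.var .i)   _    = refl
  images-agree (C.lam p)    (P.lam q)    refl = cong lam (images-agree p q refl)
  images-agree (C.app p p′) (P.app q q′) refl = cong₂ app (images-agree p q refl) (images-agree p′ q′ refl)
  images-agree (C.app (C.app () _) _) (P.pair _ _ _ _) _
  images-agree (C.pair _ _ _ _) (P.app (P.app () _) _) _
  images-agree C.X P.X R≡Rᴵ =
    ⊥-elim (<-irrefl (cong size R≡Rᴵ) (s≤s (s≤s (size-iter<iterᴵ n {var 1} {var 0} ≤-refl ≤-refl))))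
  images-agree (C.pair _ pA pB is-iter) (P.pair _ qA qB is-iterᴵ) R≡Rᴵ =
    ⊥-elim (<-irrefl (cong size R≡Rᴵ) (size-iter<iterᴵ _ (size-C≤P pA qA) (size-C≤P pB qB)))

  finish : ∀ {M R} → M P.~ G → M C.~ R → R ⟶w* G → Reaches S₁ n M
  finish (P.app (P.var 0) q) (C.app (C.var 0) p) ε =
    transport (λ t → Reaches S₁ n (app fv t)) (sym (images-agree p q refl)) (final τ ε τ-closed τ≃n)
  finish (P.app (P.var 0) _) (C.app (C.var 0) _) (appl () ◅ _)
  finish (P.app (P.pair _ _ _ ()) _) _ _
  finish (P.pair _ _ _ ()) _ _

  mutual
    drive : ∀ k {M R Rᴵ} → M C.~ R → M P.~ Rᴵ → R ⟶w* G → (sᴵ : Rᴵ ⟶w* G) → length sᴵ < k →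
      Reaches S₁ n M
    drive (suc k) p q s ε _ = finish q p s
    drive (suc k) p q s (r ◅ sᴵ) (s≤s lt) with P.~-⟶w⁻¹ q r
    ... | inj₁ (_ , m , q′) with C.~-⟶w p m
    ...   | _ , r′ , p′ =
      ≻-Reaches (wh m ◅ ε) (drive k p′ q′ (proj₁ (⟶w-toward-WhNF r′ s G-WhNF)) sᴵ lt)
    drive (suc k) p q s (r ◅ sᴵ) lt | inj₂ sp = drive-spine k sp p q s (r ◅ sᴵ) lt

    drive-spine : ∀ k {M R Rᴵ} → P.Spine M → M C.~ R → M P.~ Rᴵ → R ⟶w* G → (sᴵ : Rᴵ ⟶w* G) →
      length sᴵ < suc k → Reaches S₁ n M
    drive-spine k (P.X-spine [])       _ P.X           _ sᴵ         _ = ⊥-elim (lam-⟶w*-app sᴵ)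
    drive-spine k (P.X-spine (_ ∷ [])) _ (P.app P.X _) _ (β ◅ sᴵ)   _ = ⊥-elim (lam-⟶w*-app sᴵ)
    drive-spine k (P.X-spine (a ∷ b ∷ cs)) p q s sᴵ lt
      with C.~-apps⁻¹ (a ∷ b ∷ cs) (λ ()) p | P.~-apps⁻¹ (a ∷ b ∷ cs) (λ ()) q
    ... | C.image {args′ = a₁ ∷ b₁ ∷ cs₁} C.X (pa ∷ pb ∷ ps)
        | P.image {args′ = aᴵ ∷ bᴵ ∷ csᴵ} P.X (qa ∷ qb ∷ qs)
      with ⟶w*-toward-WhNF (⟶w*-apps csᴵ (churchᴵ-⟶w* n aᴵ bᴵ)) sᴵ G-WhNF
    ...   | sᴵ₁ , sᴵ₁≤sᴵ with ⟶w-toward-WhNF (⟶w-apps csᴵ (iterᴵ-⟶w n aᴵ bᴵ)) sᴵ₁ G-WhNF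
    ...     | sᴵ₂ , sᴵ₂<sᴵ₁ =
      step ε (Call⇒Next (X-call {a = a} {b} {cs} refl))
        (drive-restart k n ≤-refl pa pb ps qa qb qs
          (proj₁ (⟶w*-toward-WhNF (⟶w*-apps cs₁ (church-⟶w* n a₁ b₁)) s G-WhNF))
          sᴵ₂ (<-≤-trans sᴵ₂<sᴵ₁ (≤-trans sᴵ₁≤sᴵ (≤-pred lt))))
    drive-spine k (P.Xc-spine l a b cs A B rest) p q s sᴵ lt
      with C.~-apps⁻¹ rest (λ ()) p | P.~-apps⁻¹ rest (λ ()) q
    ... | C.image (C.app (C.app () _) _) _ | _
    ... | _ | P.image (P.app (P.app () _) _) _
    ... | C.image (C.pair l<n pA pB is-iter) ps
        | P.image {args′ = restᴵ} (P.pair {A′ = Aᴵ} {Bᴵ} _ qA qB is-iterᴵ) qs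
      with ⟶w-toward-WhNF (⟶w-apps restᴵ (iterᴵ-⟶w l Aᴵ Bᴵ)) sᴵ G-WhNF
    ...   | sᴵ₁ , sᴵ₁<sᴵ =
      step ε (Call⇒Next (Xc-call {a = a} {b} {cs} {A} {B} {rest} l<n))
        (drive-restart k l (<⇒≤ l<n) pA pB ps qA qB qs s sᴵ₁ (<-≤-trans sᴵ₁<sᴵ (≤-pred lt)))

    drive-restart : ∀ k l {A B rest A₁ B₁ rest₁ Aᴵ Bᴵ restᴵ} → l ≤ n →
      A C.~ A₁ → B C.~ B₁ → rest C.~* rest₁ → A P.~ Aᴵ → B P.~ Bᴵ → rest P.~* restᴵ →
      apps (iter l (app A₁) B₁) rest₁ ⟶w* G → (sᴵ : apps (iterᴵ-body l Aᴵ Bᴵ) restᴵ ⟶w* G) →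
      length sᴵ < k → Reaches S₁ n (restart l A B rest)
    drive-restart k l {A} {B} {rest} l≤n pA pB ps qA qB qs s sᴵ lt =
      ≻-Reaches (⟶w*⇒≻ (restart-⟶w* l A B rest))
        (drive k (C.restart-~ l l≤n pA pB ps (iter-Unfolding l))
                 (P.restart-~ l l≤n qA qB qs (iterᴵ-body-Unfolding l)) s sᴵ lt)

  Storage⇒Reaches : ∀ {T} → ClosedΛ T →
    app (app T (church n)) fv ≻ G → app (app T (churchᴵ n)) fv ≻ G →
    Reaches S₁ n (app (app T (X n)) fv)
  Storage⇒Reaches T-closed h hᴵ =
    drive (suc (length sᴵ)) (C.app (C.app (C.WS⇒~-refl T-closed) C.X) (C.var 0))
                            (P.app (P.app (P.WS⇒~-refl T-closed) P.X) (P.var 0))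
                            (≻-Neutral⇒⟶w* h (app var)) sᴵ ≤-refl
    where
    sᴵ = ≻-Neutral⇒⟶w* hᴵ (app var)

Storage⇒SStorage : ∀ T → ClosedΛ T → StorageOperator T → SStorageOperator S₁ T
Storage⇒SStorage T T-closed T-stores n with T-stores n
... | τ , τ-closed , τ≃n , T-θ-f≻f-τ =
  ReplayAgainstStorage.Storage⇒Reaches n τ τ-closed τ≃n T-closed
    (T-θ-f≻f-τ (church n) (church-closed n) ε)
    (T-θ-f≻f-τ (churchᴵ n) (churchᴵ-closed n) (churchᴵ≃church n))

theorem2 : (T : Tm) → ClosedΛ T → (SStorageOperator S₁ T ⇔ StorageOperator T)
theorem2 T T-closed = mk⇔ (SStorage⇒Storage T T-closed) (Storage⇒SStorage T T-closed)
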